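{- $\sum_{1\le j\le\mathtt w}|\mathrm{SubIB}_j|<2\tilde r$ and $\sum_{1\le j\le\mathtt w}|\mathrm{SubIF}_j|<2\tilde r$.
   Context: Let $S_1,\dots,S_{\mathtt h}$ be strings (haplotypes), not necessarily distinct, each of length $\mathtt w$ over the ordered alphabet $\{0,\dots,\sigma-1\}$. The prefix array $\mathrm{PA}$ is the $\mathtt h\times\mathtt w$ matrix whose column 1 is $1,\dots,\mathtt h$ and whose column $j>1$ lists the indices $k$ sorted by the co-lexicographic order (comparison from the last symbol backwards) of $S_k[1..j-1]$, ties broken by increasing $k$. The PBWT is the $\mathtt h\times\mathtt w$ matrix with $\mathrm{PBWT}[i][j]=S_{\mathrm{PA}[i][j]}[j]$. A run interval of column $j$ is a maximal interval $[b,e]$ of rows with $\mathrm{PBWT}[b][j]=\dots=\mathrm{PBWT}[e][j]$; $\mathrm{intervals}_j$ is the list of run intervals of column $j$ sorted by left endpoint, $r_j=|\mathrm{intervals}_j|$, $\tilde r=\sum_j r_j$. For $1\le j<\mathtt w$, $\mathrm{fore}[i][j]$ is the row $i^*$ with $\mathrm{PA}[i^*][j+1]=\mathrm{PA}[i][j]$; for $1<j\le\mathtt w$, $\mathrm{back}[i][j]$ is the row $i^*$ with $\mathrm{PA}[i^*][j-1]=\mathrm{PA}[i][j]$. For a list $L$ of intervals each contained in a run interval of column $j$, $\mathrm{foreL}_j(L)=\{[\mathrm{fore}[b][j],\mathrm{fore}[e][j]]:[b,e]\in L\}$ sorted by left endpoint; $\mathrm{backL}_j(L)$ is defined analogously with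 $\mathrm{back}[\cdot][j]$. Normalization: given two partitions $I_p,I_q$ of $[1,n]$ into consecutive intervals, $\mathrm{normalization}(I_p,I_q)$ processes the intervals of $I_p$ from left to right; for the current interval $[a,a']$: if it intersects at most three intervals of $I_q$, output it and move to the next interval of $I_p$; otherwise let $d$ be the largest integer such that $[a,d]$ intersects exactly three intervals of $I_q$, output $[a,d]$ and continue with $[d+1,a']$ as the current interval. Sub-run lists: $\mathrm{SubIB}_1=\mathrm{intervals}_1$ and, for $j=2,\dots,\mathtt w$, $\mathrm{SubIB}_j=\mathrm{normalization}(\mathrm{intervals}_j,\mathrm{foreL}_{j-1}(\mathrm{SubIB}_{j-1}))$. $\mathrm{SubIF}_{\mathtt w}=\mathrm{intervals}_{\mathtt w}$ and, for $j=\mathtt w-1$ down to $1$, $\mathrm{SubIF}'_{j+1}=\mathrm{normalization}(\mathrm{foreL}_j(\mathrm{intervals}_j),\mathrm{SubIF}_{j+1})$ and $\mathrm{SubIF}_j=\mathrm{backL}_{j+1}(\mathrm{SubIF}'_{j+1})$. -}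

module Defs where

open import Data.Bool using (Bool; true; false; if_then_else_; _∧_; _∨_; not)
open import Data.Nat using (ℕ; zero; suc; _+_; _∸_; _<ᵇ_; _≡ᵇ_; _≤ᵇ_)
open import Data.Fin using (Fin; toℕ)
open import Data.Vec using (Vec; toList)
open import Data.List using (List; []; _∷_; _++_; [_]; length; map; reverse; take;
  concatMap; foldr; upTo; allFin)
open import Data.Nat.ListAction using (sum)
open import Data.Product using (_×_; _,_; proj₁; proj₂)

-- Rows (positions in a column of PA / PBWT), haplotype
-- indices and columns are all 0-based here (row i here = row i+1 of the
-- paper, column j here = column j+1 of the paper).

Interval : Set
Interval = ℕ × ℕ

lexLT : List ℕ → List ℕ → Bool
lexLT []       []       = false
lexLT []       (_ ∷ _)  = true
lexLT (_ ∷ _)  []       = false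
lexLT (a ∷ as) (b ∷ bs) = (a <ᵇ b) ∨ ((a ≡ᵇ b) ∧ lexLT as bs)

insertBy : {A : Set} → (A → A → Bool) → A → List A → List A
insertBy lt x []       = x ∷ []
insertBy lt x (y ∷ ys) = if lt x y then x ∷ y ∷ ys else y ∷ insertBy lt x ys

sortBy : {A : Set} → (A → A → Bool) → List A → List A
sortBy lt = foldr (insertBy lt) []

-- position of the first occurrence of x in a list (length of list if absent)
indexOf : ℕ → List ℕ → ℕ
indexOf x []       = 0
indexOf x (y ∷ ys) = if x ≡ᵇ y then 0 else suc (indexOf x ys)

nthD : {A : Set} → A → List A → ℕ → A
nthD d []       _       = d
nthD d (x ∷ xs) zero    = x
nthD d (x ∷ xs) (suc i) = nthD d xs i

nth : List ℕ → ℕ → ℕ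
nth = nthD 0

Σ< : ℕ → (ℕ → ℕ) → ℕ
Σ< n f = sum (map f (upTo n))

-- runsFrom p xs : maximal runs of xs, positions shifted by p,
-- as triples (symbol , b , e)
runsFrom : ℕ → List ℕ → List (ℕ × Interval)
runsFrom p []       = []
runsFrom p (x ∷ xs) with runsFrom (suc p) xs
... | []                    = (x , p , p) ∷ []
... | (y , b , e) ∷ rest    =
  if x ≡ᵇ y then (x , p , e) ∷ rest else (x , p , p) ∷ (y , b , e) ∷ rest

runIntervals : List ℕ → List Interval
runIntervals xs = map proj₂ (runsFrom 0 xs)

intersects : ℕ → ℕ → Interval → Bool
intersects a d (b , e) = (b ≤ᵇ d) ∧ (a ≤ᵇ e)

countInter : List Interval → ℕ → ℕ → ℕ
countInter []       a d = 0
countInter (I ∷ Iq) a d = (if intersects a d I then 1 else 0) + countInter Iq a d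

-- largest d ∈ [a, a + k] with p d = true (default a if none)
largestIn : (ℕ → Bool) → ℕ → ℕ → ℕ
largestIn p a zero    = a
largestIn p a (suc k) = if p (a + suc k) then a + suc k else largestIn p a k

-- Processing of a single current interval [a,a'] of I_p against I_q.
-- 'fuel' bounds the number of splitting steps; each step removes at least
-- one element from the current interval, so fuel = a' - a + 1 suffices
-- (see normInterval below).
normStep : List Interval → ℕ → ℕ → ℕ → List Interval
normStep Iq zero     a a' = (a , a') ∷ []
normStep Iq (suc f)  a a' =
  if countInter Iq a a' ≤ᵇ 3
  then (a , a') ∷ []
  else (let d = largestIn (λ x → countInter Iq a x ≡ᵇ 3) a (a' ∸ a)
        in (a , d) ∷ normStep Iq f (suc d) a')

normInterval : List Interval → Interval → List Interval
normInterval Iq (a , a') = normStep Iq (suc (a' ∸ a)) a a'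

normalization : List Interval → List Interval → List Interval
normalization Ip Iq = concatMap (normInterval Iq) Ip

module PBWT {h w σ : ℕ} (S : Fin h → Vec (Fin σ) w) where

  row : Fin h → List ℕ
  row k = map toℕ (toList (S k))

  sym : ℕ → ℕ → ℕ
  sym k j = nth (nthD [] (map row (allFin h)) k) j

  -- sort key for column j: reversed prefix S_k[0..j-1] (co-lexicographic
  -- order of the prefixes), then the index k to break ties.
  key : ℕ → Fin h → List ℕ
  key j k = reverse (take j (row k)) ++ [ toℕ k ]

  PA : ℕ → List ℕ
  PA j = map proj₂ (sortBy (λ x y → lexLT (proj₁ x) (proj₁ y))
                           (map (λ k → key j k , toℕ k) (allFin h)))

  PBWTcol : ℕ → List ℕ
  PBWTcol j = map (λ k → sym k j) (PA j)

  intervals : ℕ → List Interval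
  intervals j = runIntervals (PBWTcol j)

  r : ℕ → ℕ
  r j = length (intervals j)

  r̃ : ℕ
  r̃ = Σ< w r

  -- fore[i][j] (defined for j < w-1) and back[i][j] (defined for j ≥ 1)
  fore : ℕ → ℕ → ℕ
  fore j i = indexOf (nth (PA j) i) (PA (suc j))

  back : ℕ → ℕ → ℕ
  back j i = indexOf (nth (PA j) i) (PA (j ∸ 1))

  sortByLeft : List Interval → List Interval
  sortByLeft = sortBy (λ x y → proj₁ x <ᵇ proj₁ y)

  foreL : ℕ → List Interval → List Interval
  foreL j L = sortByLeft (map (λ I → fore j (proj₁ I) , fore j (proj₂ I)) L)

  backL : ℕ → List Interval → List Interval
  backL j L = sortByLeft (map (λ I → back j (proj₁ I) , back j (proj₂ I)) L)

  SubIB : ℕ → List Interval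
  SubIB zero    = intervals zero
  SubIB (suc j) = normalization (intervals (suc j)) (foreL j (SubIB j))

  -- SubIF indexed by distance m from the last column: SubIFfromEnd m = SubIF_{w-1-m}
  SubIFfromEnd : ℕ → List Interval
  SubIFfromEnd zero    = intervals (w ∸ 1)
  SubIFfromEnd (suc m) =
    let j = w ∸ 2 ∸ m
    in backL (suc j) (normalization (foreL j (intervals j)) (SubIFfromEnd m))

  SubIF : ℕ → List Interval
  SubIF j = SubIFfromEnd (w ∸ 1 ∸ j)

{-# OPTIONS --safe #-}
-- Normalization cuts each interval of I_p into pieces, every piece but the last containing the right
-- ends of at least three intervals of the disjoint family I_q; as the intervals of I_p are disjoint,
-- each right end is counted once, so 3 |normalization I_p I_q| ≤ 3 |I_p| + |I_q|.
-- By the LF property the rows of a run of column j occupy consecutive rows of column j + 1 in the same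
-- order, and fore, back are inverse bijections between adjacent columns; hence foreL and backL keep
-- the number of intervals and their disjointness. This gives 3 |SubIB_{j+1}| ≤ 3 r_{j+1} + |SubIB_j|
-- and 3 |SubIF_j| ≤ 3 r_j + |SubIF_{j+1}|, and summing either recurrence yields 2 Σ_j |SubIB_j| ≤ 3 r̃,
-- resp. 2 Σ_j |SubIF_j| ≤ 3 r̃, which is less than 4 r̃ because r̃ ≥ 1.
module Submission where

open import Defs
open import Data.Bool using (Bool; true; false; T; if_then_else_)
open import Data.Bool.Properties using (T-∧; T-∨)
open import Data.Empty using (⊥; ⊥-elim)
open import Data.Fin as Fin using (Fin; toℕ; fromℕ<)
open import Data.Fin.Properties using (any?; toℕ-fromℕ<; toℕ<n; toℕ-injective)
open import Data.List using (List; []; _∷_; _++_; [_]; _∷ʳ_; length; map; allFin; tabulate; take; reverse; upTo)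
open import Data.List.Properties
  using ( map-++; map-∘; map-cong; map-tabulate; map-applyUpTo; map-upTo; length-++; length-map; length-tabulate
        ; upTo-∷ʳ; ∷ʳ-injectiveʳ; reverse-++)
open import Data.List.Membership.Propositional using (_∈_)
open import Data.List.Membership.Propositional.Properties using (∈-allFin; ∈-map⁺; ∈-map⁻)
open import Data.List.Relation.Binary.Lex.Core using (base; halt; this; next)
open import Data.List.Relation.Binary.Lex.Strict using (Lex-<; <-irreflexive; <-transitive; <-compare)
open import Data.List.Relation.Binary.Permutation.Propositional
  using (_↭_; prep; swap; ↭-refl; ↭-trans; ↭-sym; ↭-reflexive; ↭⇒↭ₛ)
open import Data.List.Relation.Binary.Permutation.Propositional.Properties using (All-resp-↭; ∈-resp-↭; ↭-length)
import Data.List.Relation.Binary.Permutation.Propositional.Properties as ↭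
open import Data.List.Relation.Binary.Pointwise using (≡⇒Pointwise-≡; Pointwise-≡⇒≡)
open import Data.List.Relation.Unary.All as All using (All; []; _∷_)
open import Data.List.Relation.Unary.All.Properties using (++⁺) renaming (map⁺ to All-map⁺)
open import Data.List.Relation.Unary.AllPairs as AllPairs using (AllPairs; []; _∷_)
import Data.List.Relation.Unary.AllPairs.Properties as AllPairs
open import Data.List.Relation.Unary.Any using (here; there)
open import Data.List.Relation.Unary.Unique.Propositional using (Unique)
import Data.List.Relation.Unary.Unique.Propositional.Properties as Unique
open import Data.Nat
open import Data.Nat.ListAction using (sum)
open import Data.Nat.ListAction.Properties using (sum-++; sum-↭)
open import Data.Nat.Properties
open import Algebra.Properties.CommutativeSemigroup +-commutativeSemigroup using (interchange)
open import Data.Nat.Tactic.RingSolver using (solve-∀)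
open import Data.Product using (_×_; _,_; proj₁; proj₂; ∃-syntax)
open import Data.Sum using (_⊎_; inj₁; inj₂; [_,_]′)
open import Data.Sum.Function.Propositional using (_⊎-⇔_)
open import Data.Unit using (⊤; tt)
open import Data.Vec using (Vec; toList)
open import Data.Vec.Properties using (length-toList)
open import Function using (id; _∘_; _⇔_; mk⇔; Equivalence)
import Function.Properties.Equivalence as ⇔
open import Relation.Binary.Definitions using (tri<; tri≈; tri>)
open import Relation.Binary.PropositionalEquality hiding ([_])
open import Data.List.Relation.Binary.Permutation.Setoid.Properties (setoid ℕ) using (Unique-resp-↭)
open import Relation.Nullary using (¬_; yes; no; Reflects; ofʸ; ofⁿ; proof)
open import Relation.Nullary.Reflects using (fromEquivalence)

-- Counting intervals

ind : Bool → ℕ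
ind b = if b then 1 else 0

ind-true : ∀ {b} → T b → ind b ≡ 1
ind-true {true} _ = refl

ind-false : ∀ {b} → ¬ T b → ind b ≡ 0
ind-false {false} _ = refl
ind-false {true} ¬b = ⊥-elim (¬b tt)

ind≤1 : ∀ b → ind b ≤ 1
ind≤1 true = ≤-refl
ind≤1 false = z≤n

ind-mono : ∀ {a b} → (T a → T b) → ind a ≤ ind b
ind-mono {false} _ = z≤n
ind-mono {true} {true} _ = ≤-refl
ind-mono {true} {false} a⇒b = ⊥-elim (a⇒b tt)

ind-≤-+ : ∀ {a b c} → (T a → T b ⊎ T c) → ind a ≤ ind b + ind c
ind-≤-+ {false} _ = z≤n
ind-≤-+ {true} {true} _ = s≤s z≤n
ind-≤-+ {true} {false} {true} _ = ≤-refl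
ind-≤-+ {true} {false} {false} a⇒b⊎c with a⇒b⊎c tt
... | inj₁ ()
... | inj₂ ()

ind-+-≤ : ∀ {a b c} → (T a → T b → ⊥) → (T a → T c) → (T b → T c) → ind a + ind b ≤ ind c
ind-+-≤ {false} {false} _ _ _ = z≤n
ind-+-≤ {false} {true} _ _ b⇒c = ind-mono b⇒c
ind-+-≤ {true} {false} _ a⇒c _ = ind-mono a⇒c
ind-+-≤ {true} {true} a#b _ _ = ⊥-elim (a#b tt tt)

ind-≡-+ : ∀ {a b c} → T a ⇔ (T b ⊎ T c) → (T b → T c → ⊥) → ind a ≡ ind b + ind c
ind-≡-+ a⇔b⊎c b#c = ≤-antisym (ind-≤-+ to) (ind-+-≤ b#c (from ∘ inj₁) (from ∘ inj₂))
  where open Equivalence a⇔b⊎c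

private variable
  A B : Set

∑ : List A → (A → ℕ) → ℕ
∑ xs f = sum (map f xs)

∑-mono : ∀ {f g : A → ℕ} {xs} → All (λ x → f x ≤ g x) xs → ∑ xs f ≤ ∑ xs g
∑-mono [] = z≤n
∑-mono (p ∷ ps) = +-mono-≤ p (∑-mono ps)

∑-mono′ : ∀ {f g : A → ℕ} xs → (∀ x → f x ≤ g x) → ∑ xs f ≤ ∑ xs g
∑-mono′ xs f≤g = ∑-mono {xs = xs} (All.tabulate (λ {x} _ → f≤g x))

∑-mono-< : ∀ {f g : A → ℕ} {xs x} → x ∈ xs → f x < g x → (∀ y → f y ≤ g y) → ∑ xs f < ∑ xs g
∑-mono-< {xs = y ∷ xs} (here refl) fx<gx f≤g = +-mono-<-≤ fx<gx (∑-mono′ xs f≤g)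
∑-mono-< {xs = y ∷ xs} (there x∈xs) fx<gx f≤g = +-mono-≤-< (f≤g y) (∑-mono-< x∈xs fx<gx f≤g)

∑-cong : ∀ {f g : A → ℕ} xs → (∀ x → f x ≡ g x) → ∑ xs f ≡ ∑ xs g
∑-cong [] _ = refl
∑-cong (x ∷ xs) f≗g = cong₂ _+_ (f≗g x) (∑-cong xs f≗g)

∑-+ : ∀ (f g : A → ℕ) xs → ∑ xs (λ x → f x + g x) ≡ ∑ xs f + ∑ xs g
∑-+ f g [] = refl
∑-+ f g (x ∷ xs) = trans (cong (f x + g x +_) (∑-+ f g xs)) (interchange (f x) (g x) _ _)

∑-↭ : ∀ {xs ys} (f : A → ℕ) → xs ↭ ys → ∑ xs f ≡ ∑ ys f
∑-↭ f xs↭ys = sum-↭ (↭.map⁺ f xs↭ys)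

∑-const : ∀ c (xs : List A) → ∑ xs (λ _ → c) ≡ c * length xs
∑-const c [] = sym (*-zeroʳ c)
∑-const c (x ∷ xs) = trans (cong (c +_) (∑-const c xs)) (sym (*-suc c (length xs)))

∑-swap : ∀ (F : A → B → ℕ) xs ys → ∑ xs (λ x → ∑ ys (F x)) ≡ ∑ ys (λ y → ∑ xs (λ x → F x y))
∑-swap F [] ys = sym (∑-const 0 ys)
∑-swap F (x ∷ xs) ys = trans (cong (∑ ys (F x) +_) (∑-swap F xs ys)) (sym (∑-+ (F x) _ ys))

∑-map : ∀ (f : B → ℕ) (g : A → B) xs → ∑ (map g xs) f ≡ ∑ xs (f ∘ g)
∑-map f g xs = cong sum (sym (map-∘ xs))

_∈ᵇ_ : ℕ → Interval → Bool
y ∈ᵇ I = intersects y y I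

cover : List Interval → ℕ → ℕ
cover L y = countInter L y y

Disjoint : List Interval → Set
Disjoint L = ∀ y → cover L y ≤ 1

Proper : Interval → Set
Proper (b , e) = b ≤ e

_⊆ᵢ_ : Interval → Interval → Set
(a , d) ⊆ᵢ (b , e) = b ≤ a × d ≤ e

ends : List Interval → Interval → ℕ
ends L I = ∑ L (λ J → ind (proj₂ J ∈ᵇ I))

intersects⁺ : ∀ {a d b e} → b ≤ d → a ≤ e → T (intersects a d (b , e))
intersects⁺ b≤d a≤e = Equivalence.from T-∧ (≤⇒≤ᵇ b≤d , ≤⇒≤ᵇ a≤e)

intersects⁻ : ∀ a d b e → T (intersects a d (b , e)) → b ≤ d × a ≤ e
intersects⁻ a d b e p with Equivalence.to T-∧ p
... | b≤ᵇd , a≤ᵇe = ≤ᵇ⇒≤ b d b≤ᵇd , ≤ᵇ⇒≤ a e a≤ᵇe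

countInter≡∑ : ∀ L a d → countInter L a d ≡ ∑ L (λ I → ind (intersects a d I))
countInter≡∑ [] a d = refl
countInter≡∑ (I ∷ L) a d = cong (ind (intersects a d I) +_) (countInter≡∑ L a d)

countInter-++ : ∀ L M a d → countInter (L ++ M) a d ≡ countInter L a d + countInter M a d
countInter-++ [] M a d = refl
countInter-++ (I ∷ L) M a d = trans (cong (ind (intersects a d I) +_) (countInter-++ L M a d))
                                    (sym (+-assoc (ind (intersects a d I)) _ _))

countInter-↭ : ∀ {L M} a d → L ↭ M → countInter L a d ≡ countInter M a d
countInter-↭ {L} {M} a d L↭M = begin
  countInter L a d                         ≡⟨ countInter≡∑ L a d ⟩
  ∑ L (λ I → ind (intersects a d I))       ≡⟨ ∑-↭ _ L↭M ⟩
  ∑ M (λ I → ind (intersects a d I))       ≡⟨ countInter≡∑ M a d ⟨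
  countInter M a d                         ∎
  where open ≡-Reasoning

Disjoint-↭ : ∀ {L M} → L ↭ M → Disjoint L → Disjoint M
Disjoint-↭ L↭M L-disjoint y = subst (_≤ 1) (countInter-↭ y y L↭M) (L-disjoint y)

countInter-mono : ∀ L {a x y} → x ≤ y → countInter L a x ≤ countInter L a y
countInter-mono [] x≤y = z≤n
countInter-mono ((b , e) ∷ L) {a} {x} {y} x≤y = +-mono-≤ (ind-mono widen) (countInter-mono L x≤y)
  where
  widen : T (intersects a x (b , e)) → T (intersects a y (b , e))
  widen p = let b≤x , a≤e = intersects⁻ a x b e p in intersects⁺ (≤-trans b≤x x≤y) a≤e

countInter-suc : ∀ L {a x} → countInter L a (suc x) ≤ ends L (a , x) + cover L (suc x)
countInter-suc [] = z≤n
countInter-suc ((b , e) ∷ L) {a} {x} =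
  ≤-trans (+-mono-≤ (ind-≤-+ endsOrCovers) (countInter-suc L))
          (≤-reflexive (interchange (ind (e ∈ᵇ (a , x))) (ind (suc x ∈ᵇ (b , e)))
                                    (ends L (a , x)) (cover L (suc x))))
  where
  endsOrCovers : T (intersects a (suc x) (b , e)) → T (e ∈ᵇ (a , x)) ⊎ T (suc x ∈ᵇ (b , e))
  endsOrCovers p with intersects⁻ a (suc x) b e p | e ≤? x
  ... | _ , a≤e | yes e≤x = inj₁ (intersects⁺ a≤e e≤x)
  ... | b≤1+x , _ | no e≰x = inj₂ (intersects⁺ b≤1+x (≰⇒> e≰x))

ends≤countInter : ∀ {L a x} → All Proper L → ends L (a , x) ≤ countInter L a x
ends≤countInter [] = z≤n
ends≤countInter {(b , e) ∷ L} {a} {x} (b≤e ∷ L-proper) =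
  +-mono-≤ (ind-mono intersecting) (ends≤countInter L-proper)
  where
  intersecting : T (e ∈ᵇ (a , x)) → T (intersects a x (b , e))
  intersecting p = let a≤e , e≤x = intersects⁻ e e a x p in intersects⁺ (≤-trans b≤e e≤x) a≤e

∈ᵇ-split : ∀ {a d a'} y → a ≤ suc d → d ≤ a' →
  ind (y ∈ᵇ (a , d)) + ind (y ∈ᵇ (suc d , a')) ≤ ind (y ∈ᵇ (a , a'))
∈ᵇ-split {a} {d} {a'} y a≤1+d d≤a' = ind-+-≤ apart left right
  where
  apart : T (y ∈ᵇ (a , d)) → T (y ∈ᵇ (suc d , a')) → ⊥
  apart p q = <⇒≱ (proj₁ (intersects⁻ y y (suc d) a' q)) (proj₂ (intersects⁻ y y a d p))
  left : T (y ∈ᵇ (a , d)) → T (y ∈ᵇ (a , a'))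
  left p = let a≤y , y≤d = intersects⁻ y y a d p in intersects⁺ a≤y (≤-trans y≤d d≤a')
  right : T (y ∈ᵇ (suc d , a')) → T (y ∈ᵇ (a , a'))
  right p = let 1+d≤y , y≤a' = intersects⁻ y y (suc d) a' p in intersects⁺ (≤-trans a≤1+d 1+d≤y) y≤a'

ends-split : ∀ L {a d a'} → a ≤ suc d → d ≤ a' → ends L (a , d) + ends L (suc d , a') ≤ ends L (a , a')
ends-split L a≤1+d d≤a' =
  ≤-trans (≤-reflexive (sym (∑-+ _ _ L))) (∑-mono′ L (λ J → ∈ᵇ-split (proj₂ J) a≤1+d d≤a'))

∑-ends≤length : ∀ Iq {Ip} → Disjoint Ip → ∑ Ip (ends Iq) ≤ length Iq
∑-ends≤length Iq {Ip} Ip-disjoint = begin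
  ∑ Ip (ends Iq)                                          ≡⟨ ∑-swap (λ I J → ind (proj₂ J ∈ᵇ I)) Ip Iq ⟩
  ∑ Iq (λ J → ∑ Ip (λ I → ind (proj₂ J ∈ᵇ I)))            ≡⟨ ∑-cong Iq (λ J → sym (countInter≡∑ Ip _ _)) ⟩
  ∑ Iq (λ J → cover Ip (proj₂ J))                         ≤⟨ ∑-mono′ Iq (λ J → Ip-disjoint (proj₂ J)) ⟩
  ∑ Iq (λ _ → 1)                                          ≡⟨ trans (∑-const 1 Iq) (*-identityˡ _) ⟩
  length Iq                                               ∎
  where open ≤-Reasoning

-- Normalization

largestIn-bounds : ∀ (p : ℕ → Bool) a k → a ≤ largestIn p a k × largestIn p a k ≤ a + k
largestIn-bounds p a zero = ≤-refl , m≤m+n a 0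
largestIn-bounds p a (suc k) with p (a + suc k)
... | true = m≤m+n a (suc k) , ≤-refl
... | false = let a≤l , l≤a+k = largestIn-bounds p a k in a≤l , ≤-trans l≤a+k (+-monoʳ-≤ a (n≤1+n k))

largestIn-satisfies : ∀ (p : ℕ → Bool) a k {y} → y ≤ k → T (p (a + y)) → T (p (largestIn p a k))
largestIn-satisfies p a zero {y} y≤0 py rewrite n≤0⇒n≡0 y≤0 | +-identityʳ a = py
largestIn-satisfies p a (suc k) {y} y≤1+k py with p (a + suc k) in eq
... | true = subst T (sym eq) tt
... | false with m≤n⇒m<n∨m≡n y≤1+k
...   | inj₁ y<1+k = largestIn-satisfies p a k (≤-pred y<1+k) py
...   | inj₂ refl = ⊥-elim (subst T eq py)

largestIn-maximal : ∀ (p : ℕ → Bool) a k {y} → largestIn p a k < y → y ≤ a + k → ¬ T (p y)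
largestIn-maximal p a zero {y} l<y y≤a+0 = ⊥-elim (<⇒≱ l<y (subst (y ≤_) (+-identityʳ a) y≤a+0))
largestIn-maximal p a (suc k) {y} l<y y≤a+1+k with p (a + suc k) in eq
... | true = ⊥-elim (<⇒≱ l<y y≤a+1+k)
... | false with m≤n⇒m<n∨m≡n y≤a+1+k
...   | inj₁ y<a+1+k = largestIn-maximal p a k l<y (≤-pred (subst (y <_) (+-suc a k) y<a+1+k))
...   | inj₂ refl = subst T eq

unit-steps-hit : ∀ (g : ℕ → ℕ) → (∀ x → g (suc x) ≤ suc (g x)) →
  ∀ {n a} k → g a ≤ n → n ≤ g (a + k) → ∃[ y ] y ≤ k × g (a + y) ≡ n
unit-steps-hit g step {n} {a} zero ga≤n n≤ga+0 =
  0 , z≤n , ≤-antisym (subst (λ z → g z ≤ n) (sym (+-identityʳ a)) ga≤n) n≤ga+0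
unit-steps-hit g step {n} {a} (suc k) ga≤n n≤ga+1+k with n ≤? g (a + k)
... | yes n≤ga+k = let y , y≤k , gy≡n = unit-steps-hit g step k ga≤n n≤ga+k in y , m≤n⇒m≤1+n y≤k , gy≡n
... | no n≰ga+k = suc k , ≤-refl , ≤-antisym ga+1+k≤n n≤ga+1+k
  where
  ga+1+k≤n : g (a + suc k) ≤ n
  ga+1+k≤n = ≤-trans (subst (λ z → g z ≤ suc (g (a + k))) (sym (+-suc a k)) (step (a + k))) (≰⇒> n≰ga+k)

-- The end d of the first piece that normStep cuts off [a, a'].
splitPoint : List Interval → ℕ → ℕ → ℕ
splitPoint Iq a a' = largestIn (λ x → countInter Iq a x ≡ᵇ 3) a (a' ∸ a)

module Normalization {Iq : List Interval} (Iq-proper : All Proper Iq) (Iq-disjoint : Disjoint Iq) where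

  countInter-unit-step : ∀ a x → countInter Iq a (suc x) ≤ suc (countInter Iq a x)
  countInter-unit-step a x = begin
    countInter Iq a (suc x)             ≤⟨ countInter-suc Iq ⟩
    ends Iq (a , x) + cover Iq (suc x)  ≤⟨ +-mono-≤ (ends≤countInter Iq-proper) (Iq-disjoint (suc x)) ⟩
    countInter Iq a x + 1               ≡⟨ +-comm _ 1 ⟩
    suc (countInter Iq a x)             ∎
    where open ≤-Reasoning

  -- [a, d + 1] meets at least four intervals of Iq, and as Iq is disjoint at most one of them
  -- contains d + 1; all the others end inside [a, d].
  splitPoint-spec : ∀ {a a'} → a ≤ a' → 3 < countInter Iq a a' →
    a ≤ splitPoint Iq a a' × splitPoint Iq a a' < a' × 3 ≤ ends Iq (a , splitPoint Iq a a')
  splitPoint-spec {a} {a'} a≤a' 3<c[a'] = a≤d , d<a' , 3≤ends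
    where
    P : ℕ → Bool
    P x = countInter Iq a x ≡ᵇ 3
    k : ℕ
    k = a' ∸ a
    a+k≡a' : a + k ≡ a'
    a+k≡a' = m+[n∸m]≡n a≤a'
    d : ℕ
    d = splitPoint Iq a a'
    a≤d : a ≤ d
    a≤d = proj₁ (largestIn-bounds P a k)
    d≤a' : d ≤ a'
    d≤a' = subst (d ≤_) a+k≡a' (proj₂ (largestIn-bounds P a k))
    c[d]≡3 : countInter Iq a d ≡ 3
    c[d]≡3 with unit-steps-hit (countInter Iq a) (countInter-unit-step a) k
                  (≤-trans (Iq-disjoint a) (s≤s z≤n))
                  (subst (λ z → 3 ≤ countInter Iq a z) (sym a+k≡a') (<⇒≤ 3<c[a']))
    ... | y , y≤k , c[a+y]≡3 = ≡ᵇ⇒≡ _ _ (largestIn-satisfies P a k y≤k (≡⇒≡ᵇ _ _ c[a+y]≡3))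
    d<a' : d < a'
    d<a' = ≤∧≢⇒< d≤a' (λ d≡a' → <⇒≢ 3<c[a'] (trans (sym c[d]≡3) (cong (countInter Iq a) d≡a')))
    3<c[1+d] : 3 < countInter Iq a (suc d)
    3<c[1+d] = ≤∧≢⇒< (subst (_≤ countInter Iq a (suc d)) c[d]≡3 (countInter-mono Iq (n≤1+n d)))
                      (λ 3≡c → largestIn-maximal P a k ≤-refl (subst (suc d ≤_) (sym a+k≡a') d<a')
                                                     (≡⇒≡ᵇ _ _ (sym 3≡c)))
    3≤ends : 3 ≤ ends Iq (a , d)
    3≤ends = +-cancelʳ-≤ 1 3 _ (begin
      4                                   ≤⟨ 3<c[1+d] ⟩
      countInter Iq a (suc d)             ≤⟨ countInter-suc Iq ⟩
      ends Iq (a , d) + cover Iq (suc d)  ≤⟨ +-monoʳ-≤ (ends Iq (a , d)) (Iq-disjoint (suc d)) ⟩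
      ends Iq (a , d) + 1                 ∎)
      where open ≤-Reasoning

  normStep-length : ∀ f {a a'} → a ≤ a' → 3 * length (normStep Iq f a a') ≤ 3 + ends Iq (a , a')
  normStep-length zero _ = m≤m+n 3 _
  normStep-length (suc f) {a} {a'} a≤a' with countInter Iq a a' ≤ᵇ 3 | ≤ᵇ-reflects-≤ (countInter Iq a a') 3
  ... | true | _ = m≤m+n 3 _
  ... | false | ofⁿ c≰3 with splitPoint-spec a≤a' (≰⇒> c≰3)
  ...   | a≤d , d<a' , 3≤ends = begin
    3 * suc (length rest)                          ≡⟨ *-suc 3 (length rest) ⟩
    3 + 3 * length rest                            ≤⟨ +-monoʳ-≤ 3 (normStep-length f d<a') ⟩
    3 + (3 + ends Iq (suc d , a'))                 ≤⟨ +-monoʳ-≤ 3 (+-monoˡ-≤ _ 3≤ends) ⟩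
    3 + (ends Iq (a , d) + ends Iq (suc d , a'))   ≤⟨ +-monoʳ-≤ 3 (ends-split Iq (m≤n⇒m≤1+n a≤d) (<⇒≤ d<a')) ⟩
    3 + ends Iq (a , a')                           ∎
    where
    open ≤-Reasoning
    d : ℕ
    d = splitPoint Iq a a'
    rest : List Interval
    rest = normStep Iq f (suc d) a'

  normStep-cover : ∀ f {a a'} → a ≤ a' → ∀ y → cover (normStep Iq f a a') y ≤ ind (y ∈ᵇ (a , a'))
  normStep-cover zero _ y = ≤-reflexive (+-identityʳ _)
  normStep-cover (suc f) {a} {a'} a≤a' y with countInter Iq a a' ≤ᵇ 3 | ≤ᵇ-reflects-≤ (countInter Iq a a') 3
  ... | true | _ = ≤-reflexive (+-identityʳ _)
  ... | false | ofⁿ c≰3 with splitPoint-spec a≤a' (≰⇒> c≰3)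
  ...   | a≤d , d<a' , _ = begin
    ind (y ∈ᵇ (a , d)) + cover (normStep Iq f (suc d) a') y  ≤⟨ +-monoʳ-≤ _ (normStep-cover f d<a' y) ⟩
    ind (y ∈ᵇ (a , d)) + ind (y ∈ᵇ (suc d , a'))             ≤⟨ ∈ᵇ-split y (m≤n⇒m≤1+n a≤d) (<⇒≤ d<a') ⟩
    ind (y ∈ᵇ (a , a'))                                      ∎
    where
    open ≤-Reasoning
    d : ℕ
    d = splitPoint Iq a a'

  normStep-⊆ : ∀ f {a a'} → a ≤ a' → All (λ J → Proper J × J ⊆ᵢ (a , a')) (normStep Iq f a a')
  normStep-⊆ zero a≤a' = (a≤a' , ≤-refl , ≤-refl) ∷ []
  normStep-⊆ (suc f) {a} {a'} a≤a' with countInter Iq a a' ≤ᵇ 3 | ≤ᵇ-reflects-≤ (countInter Iq a a') 3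
  ... | true | _ = (a≤a' , ≤-refl , ≤-refl) ∷ []
  ... | false | ofⁿ c≰3 with splitPoint-spec a≤a' (≰⇒> c≰3)
  ...   | a≤d , d<a' , _ =
    (a≤d , ≤-refl , <⇒≤ d<a') ∷
    All.map (λ (J-proper , 1+d≤c , d'≤a') → J-proper , ≤-trans (m≤n⇒m≤1+n a≤d) 1+d≤c , d'≤a')
            (normStep-⊆ f d<a')

  length-normalization-ends : ∀ {Ip} → All Proper Ip →
    3 * length (normalization Ip Iq) ≤ ∑ Ip (λ I → 3 + ends Iq I)
  length-normalization-ends [] = z≤n
  length-normalization-ends {(a , a') ∷ Ip} (a≤a' ∷ Ip-proper) = begin
    3 * length (pieces ++ normalization Ip Iq)             ≡⟨ cong (3 *_) (length-++ pieces) ⟩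
    3 * (length pieces + length (normalization Ip Iq))     ≡⟨ *-distribˡ-+ 3 (length pieces) _ ⟩
    3 * length pieces + 3 * length (normalization Ip Iq)   ≤⟨ +-mono-≤ (normStep-length (suc (a' ∸ a)) a≤a')
                                                                         (length-normalization-ends Ip-proper) ⟩
    3 + ends Iq (a , a') + ∑ Ip (λ I → 3 + ends Iq I)      ∎
    where
    open ≤-Reasoning
    pieces : List Interval
    pieces = normInterval Iq (a , a')

  length-normalization : ∀ {Ip} → All Proper Ip → Disjoint Ip →
    3 * length (normalization Ip Iq) ≤ 3 * length Ip + length Iq
  length-normalization {Ip} Ip-proper Ip-disjoint = begin
    3 * length (normalization Ip Iq)   ≤⟨ length-normalization-ends Ip-proper ⟩
    ∑ Ip (λ I → 3 + ends Iq I)         ≡⟨ ∑-+ (λ _ → 3) (ends Iq) Ip ⟩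
    ∑ Ip (λ _ → 3) + ∑ Ip (ends Iq)    ≤⟨ +-mono-≤ (≤-reflexive (∑-const 3 Ip))
                                                   (∑-ends≤length Iq {Ip} Ip-disjoint) ⟩
    3 * length Ip + length Iq          ∎
    where open ≤-Reasoning

  cover-normalization : ∀ {Ip} → All Proper Ip → ∀ y → cover (normalization Ip Iq) y ≤ cover Ip y
  cover-normalization [] y = z≤n
  cover-normalization {(a , a') ∷ Ip} (a≤a' ∷ Ip-proper) y = begin
    cover (pieces ++ normalization Ip Iq) y             ≡⟨ countInter-++ pieces _ y y ⟩
    cover pieces y + cover (normalization Ip Iq) y      ≤⟨ +-mono-≤ (normStep-cover (suc (a' ∸ a)) a≤a' y)
                                                                    (cover-normalization Ip-proper y) ⟩
    ind (y ∈ᵇ (a , a')) + cover Ip y                    ∎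
    where
    open ≤-Reasoning
    pieces : List Interval
    pieces = normInterval Iq (a , a')

  Disjoint-normalization : ∀ {Ip} → All Proper Ip → Disjoint Ip → Disjoint (normalization Ip Iq)
  Disjoint-normalization Ip-proper Ip-disjoint y = ≤-trans (cover-normalization Ip-proper y) (Ip-disjoint y)

  All-normalization : ∀ {Ip} (Q : Interval → Set) → (∀ {I J} → Q I → Proper J → J ⊆ᵢ I → Q J) →
    All Proper Ip → All Q Ip → All Q (normalization Ip Iq)
  All-normalization Q Q-⊆ [] [] = []
  All-normalization {(a , a') ∷ Ip} Q Q-⊆ (a≤a' ∷ Ip-proper) (q ∷ qs) =
    ++⁺ (All.map (λ (J-proper , J⊆I) → Q-⊆ q J-proper J⊆I) (normStep-⊆ (suc (a' ∸ a)) a≤a'))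
        (All-normalization Q Q-⊆ Ip-proper qs)

EachStep : (ℕ → Set) → Interval → Set
EachStep R (b , e) = ∀ {x} → b ≤ x → x < e → R x

Segment : ℕ → (ℕ → Set) → Interval → Set
Segment h R I = Proper I × proj₂ I < h × EachStep R I

Segment-⊆ : ∀ {h R I J} → Segment h R I → Proper J → J ⊆ᵢ I → Segment h R J
Segment-⊆ (_ , e<h , steps) J-proper (b≤a , d≤e) =
  J-proper , ≤-<-trans d≤e e<h , λ a≤x x<d → steps (≤-trans b≤a a≤x) (<-≤-trans x<d d≤e)

ShiftStep : (ℕ → ℕ) → ℕ → Set
ShiftStep g x = g (suc x) ≡ suc (g x)

mapEnds : (ℕ → ℕ) → Interval → Interval
mapEnds g (b , e) = g b , g e

shift-+ : ∀ {g b e} → EachStep (ShiftStep g) (b , e) → ∀ t → b + t ≤ e → g (b + t) ≡ g b + t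
shift-+ {g} {b} steps zero _ = trans (cong g (+-identityʳ b)) (sym (+-identityʳ (g b)))
shift-+ {g} {b} {e} steps (suc t) b+1+t≤e = begin
  g (b + suc t)     ≡⟨ cong g (+-suc b t) ⟩
  g (suc (b + t))   ≡⟨ steps (m≤m+n b t) (subst (_≤ e) (+-suc b t) b+1+t≤e) ⟩
  suc (g (b + t))   ≡⟨ cong suc (shift-+ steps t (≤-trans (+-monoʳ-≤ b (n≤1+n t)) b+1+t≤e)) ⟩
  suc (g b + t)     ≡⟨ +-suc (g b) t ⟨
  g b + suc t       ∎
  where open ≡-Reasoning

shift-Proper : ∀ {g I} → Proper I → EachStep (ShiftStep g) I → Proper (mapEnds g I)
shift-Proper {g} {b , e} b≤e steps =
  subst (g b ≤_) (trans (sym (shift-+ steps (e ∸ b) (≤-reflexive b+[e∸b]≡e))) (cong g b+[e∸b]≡e))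
        (m≤m+n (g b) (e ∸ b))
  where
  b+[e∸b]≡e : b + (e ∸ b) ≡ e
  b+[e∸b]≡e = m+[n∸m]≡n b≤e

shift-image : ∀ {g b e y} → Proper (b , e) → EachStep (ShiftStep g) (b , e) → g b ≤ y → y ≤ g e →
  ∃[ x ] b ≤ x × x ≤ e × g x ≡ y
shift-image {g} {b} {e} {y} b≤e steps gb≤y y≤ge = b + t , m≤m+n b t , b+t≤e , g[b+t]≡y
  where
  t : ℕ
  t = y ∸ g b
  b+[e∸b]≡e : b + (e ∸ b) ≡ e
  b+[e∸b]≡e = m+[n∸m]≡n b≤e
  ge≡gb+[e∸b] : g e ≡ g b + (e ∸ b)
  ge≡gb+[e∸b] = trans (cong g (sym b+[e∸b]≡e)) (shift-+ steps (e ∸ b) (≤-reflexive b+[e∸b]≡e))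
  t≤e∸b : t ≤ e ∸ b
  t≤e∸b = ≤-trans (∸-monoˡ-≤ (g b) (subst (y ≤_) ge≡gb+[e∸b] y≤ge)) (≤-reflexive (m+n∸m≡n (g b) (e ∸ b)))
  b+t≤e : b + t ≤ e
  b+t≤e = ≤-trans (+-monoʳ-≤ b t≤e∸b) (≤-reflexive b+[e∸b]≡e)
  g[b+t]≡y : g (b + t) ≡ y
  g[b+t]≡y = trans (shift-+ steps t b+t≤e) (m+[n∸m]≡n gb≤y)

module _ {h : ℕ} {g : ℕ → ℕ} (g-injective : ∀ {x y} → x < h → y < h → g x ≡ g y → x ≡ y) where

  ∈ᵇ-mapEnds : ∀ {I y} → Segment h (ShiftStep g) I → T (y ∈ᵇ mapEnds g I) →
    ∃[ x ] x < h × g x ≡ y × T (x ∈ᵇ I)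
  ∈ᵇ-mapEnds {b , e} {y} (b≤e , e<h , steps) y∈gI with intersects⁻ y y (g b) (g e) y∈gI
  ... | gb≤y , y≤ge =
    let x , b≤x , x≤e , gx≡y = shift-image b≤e steps gb≤y y≤ge
    in x , ≤-<-trans x≤e e<h , gx≡y , intersects⁺ b≤x x≤e

  cover-mapEnds : ∀ {L x} → All (Segment h (ShiftStep g)) L → x < h →
    cover (map (mapEnds g) L) (g x) ≤ cover L x
  cover-mapEnds [] _ = z≤n
  cover-mapEnds {I ∷ L} {x} (I-segment ∷ L-segments) x<h =
    +-mono-≤ (ind-mono preimage) (cover-mapEnds L-segments x<h)
    where
    preimage : T (g x ∈ᵇ mapEnds g I) → T (x ∈ᵇ I)
    preimage gx∈gI with ∈ᵇ-mapEnds I-segment gx∈gI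
    ... | x' , x'<h , gx'≡gx , x'∈I = subst (λ z → T (z ∈ᵇ I)) (g-injective x'<h x<h gx'≡gx) x'∈I

  cover-mapEnds-outside : ∀ {L y} → All (Segment h (ShiftStep g)) L → (∀ {x} → x < h → g x ≢ y) →
    cover (map (mapEnds g) L) y ≡ 0
  cover-mapEnds-outside [] _ = refl
  cover-mapEnds-outside {I ∷ L} {y} (I-segment ∷ L-segments) ∉img =
    cong₂ _+_ (ind-false (λ y∈gI → let _ , x<h , gx≡y , _ = ∈ᵇ-mapEnds I-segment y∈gI in ∉img x<h gx≡y))
              (cover-mapEnds-outside L-segments ∉img)

  Disjoint-mapEnds : ∀ {L} → All (Segment h (ShiftStep g)) L → Disjoint L → Disjoint (map (mapEnds g) L)
  Disjoint-mapEnds L-segments L-disjoint y with any? (λ (x : Fin h) → g (toℕ x) ≟ y)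
  ... | yes (x , refl) = ≤-trans (cover-mapEnds L-segments (toℕ<n x)) (L-disjoint (toℕ x))
  ... | no ∄x = subst (_≤ 1) (sym (cover-mapEnds-outside L-segments outside)) z≤n
    where
    outside : ∀ {x} → x < h → g x ≢ y
    outside {x} x<h gx≡y = ∄x (fromℕ< x<h , trans (cong g (toℕ-fromℕ< x<h)) gx≡y)

insertBy-↭ : ∀ {A : Set} (lt : A → A → Bool) x xs → insertBy lt x xs ↭ x ∷ xs
insertBy-↭ lt x [] = ↭-refl
insertBy-↭ lt x (y ∷ xs) with lt x y
... | true = ↭-refl
... | false = ↭-trans (prep y (insertBy-↭ lt x xs)) (swap y x ↭-refl)

sortBy-↭ : ∀ {A : Set} (lt : A → A → Bool) xs → sortBy lt xs ↭ xs
sortBy-↭ lt [] = ↭-refl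
sortBy-↭ lt (x ∷ xs) = ↭-trans (insertBy-↭ lt x (sortBy lt xs)) (prep x (sortBy-↭ lt xs))

module _ (lt : Interval → Interval → Bool) (g : ℕ → ℕ) (L : List Interval) where

  length-sortBy-mapEnds : length (sortBy lt (map (mapEnds g) L)) ≡ length L
  length-sortBy-mapEnds = trans (↭-length (sortBy-↭ lt (map (mapEnds g) L))) (length-map (mapEnds g) L)

  All-Proper-sortBy-mapEnds : ∀ {h} → All (Segment h (ShiftStep g)) L → All Proper (sortBy lt (map (mapEnds g) L))
  All-Proper-sortBy-mapEnds L-segments =
    All-resp-↭ (↭-sym (sortBy-↭ lt (map (mapEnds g) L)))
               (All-map⁺ (All.map (λ (b≤e , _ , steps) → shift-Proper b≤e steps) L-segments))

  Disjoint-sortBy-mapEnds : ∀ {h} → (∀ {x y} → x < h → y < h → g x ≡ g y → x ≡ y) →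
    All (Segment h (ShiftStep g)) L → Disjoint L → Disjoint (sortBy lt (map (mapEnds g) L))
  Disjoint-sortBy-mapEnds g-injective L-segments L-disjoint =
    Disjoint-↭ (↭-sym (sortBy-↭ lt (map (mapEnds g) L))) (Disjoint-mapEnds g-injective L-segments L-disjoint)

inverse-shifts : ∀ {g g' b e} → Proper (b , e) → EachStep (ShiftStep g) (b , e) →
  (∀ {x} → b ≤ x → x ≤ e → g' (g x) ≡ x) → EachStep (ShiftStep g') (mapEnds g (b , e))
inverse-shifts {g} {g'} {b} {e} b≤e steps g'∘g≡id {y} gb≤y y<ge
  with shift-image b≤e steps gb≤y (<⇒≤ y<ge)
... | x , b≤x , x≤e , refl = begin
  g' (suc (g x))     ≡⟨ cong g' (steps b≤x x<e) ⟨
  g' (g (suc x))     ≡⟨ g'∘g≡id (m≤n⇒m≤1+n b≤x) x<e ⟩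
  suc x              ≡⟨ cong suc (g'∘g≡id b≤x x≤e) ⟨
  suc (g' (g x))     ∎
  where
  open ≡-Reasoning
  x<e : x < e
  x<e = ≤∧≢⇒< x≤e (λ { refl → <-irrefl refl y<ge })

-- Lexicographic sorting and ranks

_≺_ : List ℕ → List ℕ → Set
_≺_ = Lex-< _≡_ _<_

lexLT⇒≺ : ∀ xs ys → T (lexLT xs ys) → xs ≺ ys
lexLT⇒≺ [] (y ∷ ys) _ = halt
lexLT⇒≺ (x ∷ xs) (y ∷ ys) p with Equivalence.to (T-∨ {x <ᵇ y}) p
... | inj₁ x<ᵇy = this (<ᵇ⇒< x y x<ᵇy)
... | inj₂ q = let x≡ᵇy , xs<ᵇys = Equivalence.to (T-∧ {x ≡ᵇ y}) q in next (≡ᵇ⇒≡ x y x≡ᵇy) (lexLT⇒≺ xs ys xs<ᵇys)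

≺⇒lexLT : ∀ {xs ys} → xs ≺ ys → T (lexLT xs ys)
≺⇒lexLT (base ())
≺⇒lexLT halt = tt
≺⇒lexLT (this x<y) = Equivalence.from T-∨ (inj₁ (<⇒<ᵇ x<y))
≺⇒lexLT {x ∷ _} (next refl xs≺ys) =
  Equivalence.from T-∨ (inj₂ (Equivalence.from T-∧ (≡⇒≡ᵇ x x refl , ≺⇒lexLT xs≺ys)))

lexLT-reflects : ∀ xs ys → Reflects (xs ≺ ys) (lexLT xs ys)
lexLT-reflects xs ys = fromEquivalence (lexLT⇒≺ xs ys) ≺⇒lexLT

≺-irrefl : ∀ {xs} → ¬ xs ≺ xs
≺-irrefl = <-irreflexive <-irrefl (≡⇒Pointwise-≡ refl)

≺-trans : ∀ {xs ys zs} → xs ≺ ys → ys ≺ zs → xs ≺ zs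
≺-trans = <-transitive isEquivalence (resp₂ _<_) <-trans

≺-asym : ∀ {xs ys} → xs ≺ ys → ¬ ys ≺ xs
≺-asym xs≺ys ys≺xs = ≺-irrefl (≺-trans xs≺ys ys≺xs)

≺-compare : ∀ xs ys → xs ≺ ys ⊎ xs ≡ ys ⊎ ys ≺ xs
≺-compare xs ys with <-compare sym <-cmp xs ys
... | tri< xs≺ys _ _ = inj₁ xs≺ys
... | tri≈ _ xs≋ys _ = inj₂ (inj₁ (Pointwise-≡⇒≡ xs≋ys))
... | tri> _ _ ys≺xs = inj₂ (inj₂ ys≺xs)

≺-∷-≡⇔ : ∀ {a b xs ys} → a ≡ b → (a ∷ xs) ≺ (b ∷ ys) ⇔ xs ≺ ys
≺-∷-≡⇔ refl = mk⇔ (λ { (this a<a) → ⊥-elim (<-irrefl refl a<a) ; (next _ xs≺ys) → xs≺ys }) (next refl)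

≺-∷-head : ∀ {a b xs ys} → (a ∷ xs) ≺ (b ∷ ys) → a ≤ b
≺-∷-head (this a<b) = <⇒≤ a<b
≺-∷-head (next refl _) = ≤-refl

≡ᵇ-reflects-≡ : ∀ m n → Reflects (m ≡ n) (m ≡ᵇ n)
≡ᵇ-reflects-≡ m n = proof (m ≟ n)

ltKey : List ℕ × ℕ → List ℕ × ℕ → Bool
ltKey p q = lexLT (proj₁ p) (proj₁ q)

KeySorted : List (List ℕ × ℕ) → Set
KeySorted = AllPairs (λ p q → proj₁ p ≺ proj₁ q)

insertBy-sorted : ∀ x ys → KeySorted ys → All (λ y → proj₁ x ≢ proj₁ y) ys → KeySorted (insertBy ltKey x ys)
insertBy-sorted x [] _ _ = [] ∷ []
insertBy-sorted x (y ∷ ys) (y≺ys ∷ ys-sorted) (x≢y ∷ x≢ys)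
  with lexLT (proj₁ x) (proj₁ y) | lexLT-reflects (proj₁ x) (proj₁ y)
... | true | ofʸ x≺y = (x≺y ∷ All.map (≺-trans x≺y) y≺ys) ∷ y≺ys ∷ ys-sorted
... | false | ofⁿ x⊀y =
  All-resp-↭ (↭-sym (insertBy-↭ ltKey x ys)) (y≺x ∷ y≺ys) ∷ insertBy-sorted x ys ys-sorted x≢ys
  where
  y≺x : proj₁ y ≺ proj₁ x
  y≺x with ≺-compare (proj₁ x) (proj₁ y)
  ... | inj₁ x≺y = ⊥-elim (x⊀y x≺y)
  ... | inj₂ (inj₁ x≡y) = ⊥-elim (x≢y x≡y)
  ... | inj₂ (inj₂ y≺x) = y≺x

sortBy-sorted : ∀ xs → AllPairs (λ p q → proj₁ p ≢ proj₁ q) xs → KeySorted (sortBy ltKey xs)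
sortBy-sorted [] [] = []
sortBy-sorted (x ∷ xs) (x≢xs ∷ xs-distinct) =
  insertBy-sorted x (sortBy ltKey xs) (sortBy-sorted xs xs-distinct) (All-resp-↭ (↭-sym (sortBy-↭ ltKey xs)) x≢xs)

indexOf-sorted : ∀ {κ n} ys → KeySorted ys → (κ , n) ∈ ys → (∀ {q} → q ∈ ys → proj₂ q ≡ n → proj₁ q ≡ κ) →
  indexOf n (map proj₂ ys) ≡ ∑ ys (λ q → ind (lexLT (proj₁ q) κ))
indexOf-sorted {κ} {n} ((κ' , n') ∷ ys) (κ'≺ys ∷ ys-sorted) κn∈ n-determines-key
  with n ≡ᵇ n' | ≡ᵇ-reflects-≡ n n'
... | true | ofʸ refl with n-determines-key (here refl) refl
...   | refl = sym (cong₂ _+_ (ind-false (≺-irrefl ∘ lexLT⇒≺ κ κ)) (n≤0⇒n≡0 nothing-below))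
  where
  nothing-below : ∑ ys (λ q → ind (lexLT (proj₁ q) κ)) ≤ 0
  nothing-below = subst (∑ ys (λ q → ind (lexLT (proj₁ q) κ)) ≤_) (∑-const 0 ys)
    (∑-mono (All.map (λ κ≺q → ≤-reflexive (ind-false (≺-asym κ≺q ∘ lexLT⇒≺ _ κ))) κ'≺ys))
indexOf-sorted {κ} ((κ' , n') ∷ ys) (κ'≺ys ∷ ys-sorted) (here refl) _ | false | ofⁿ n≢n' = ⊥-elim (n≢n' refl)
indexOf-sorted {κ} ((κ' , n') ∷ ys) (κ'≺ys ∷ ys-sorted) (there κn∈ys) n-determines-key | false | ofⁿ _ =
  trans (cong suc (indexOf-sorted ys ys-sorted κn∈ys (n-determines-key ∘ there)))
        (cong (_+ _) (sym (ind-true (≺⇒lexLT (All.lookup κ'≺ys κn∈ys)))))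

nth-indexOf : ∀ {x} xs → x ∈ xs → nth xs (indexOf x xs) ≡ x
nth-indexOf {x} (y ∷ xs) x∈ with x ≡ᵇ y | ≡ᵇ-reflects-≡ x y
... | true | ofʸ x≡y = sym x≡y
... | false | ofⁿ x≢y with x∈
...   | here x≡y = ⊥-elim (x≢y x≡y)
...   | there x∈xs = nth-indexOf xs x∈xs

indexOf<length : ∀ {x} xs → x ∈ xs → indexOf x xs < length xs
indexOf<length {x} (y ∷ xs) x∈ with x ≡ᵇ y | ≡ᵇ-reflects-≡ x y
... | true | _ = s≤s z≤n
... | false | ofⁿ x≢y with x∈
...   | here x≡y = ⊥-elim (x≢y x≡y)
...   | there x∈xs = s≤s (indexOf<length xs x∈xs)

nth∈ : ∀ xs {i} → i < length xs → nth xs i ∈ xs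
nth∈ (x ∷ xs) {zero} _ = here refl
nth∈ (x ∷ xs) {suc i} i<1+n = there (nth∈ xs (≤-pred i<1+n))

indexOf-nth : ∀ xs {i} → Unique xs → i < length xs → indexOf (nth xs i) xs ≡ i
indexOf-nth (x ∷ xs) {zero} _ _ with x ≡ᵇ x | ≡ᵇ-reflects-≡ x x
... | true | _ = refl
... | false | ofⁿ x≢x = ⊥-elim (x≢x refl)
indexOf-nth (x ∷ xs) {suc i} (x∉xs ∷ xs-unique) i<1+n with nth xs i ≡ᵇ x | ≡ᵇ-reflects-≡ (nth xs i) x
... | true | ofʸ xᵢ≡x = ⊥-elim (All.lookup x∉xs (nth∈ xs (≤-pred i<1+n)) (sym xᵢ≡x))
... | false | _ = cong suc (indexOf-nth xs xs-unique (≤-pred i<1+n))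

nth-map : ∀ (f : ℕ → ℕ) xs {i} → i < length xs → nth (map f xs) i ≡ f (nth xs i)
nth-map f (x ∷ xs) {zero} _ = refl
nth-map f (x ∷ xs) {suc i} i<1+n = nth-map f xs (≤-pred i<1+n)

lexLT⇔≺ : ∀ xs ys → T (lexLT xs ys) ⇔ xs ≺ ys
lexLT⇔≺ xs ys = mk⇔ (lexLT⇒≺ xs ys) ≺⇒lexLT

toℕ-≡ᵇ⇔≡ : ∀ {n} (x y : Fin n) → T (toℕ x ≡ᵇ toℕ y) ⇔ x ≡ y
toℕ-≡ᵇ⇔≡ x y = mk⇔ (toℕ-injective ∘ ≡ᵇ⇒≡ (toℕ x) (toℕ y)) (≡⇒≡ᵇ (toℕ x) (toℕ y) ∘ cong toℕ)

∑-allFin-suc : ∀ {n} (f : Fin (suc n) → ℕ) → ∑ (allFin (suc n)) f ≡ f Fin.zero + ∑ (allFin n) (f ∘ Fin.suc)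
∑-allFin-suc f =
  cong (f Fin.zero +_) (cong sum (trans (map-tabulate Fin.suc f) (sym (map-tabulate id (f ∘ Fin.suc)))))

∑-allFin-single : ∀ {n} (k : Fin n) → ∑ (allFin n) (λ x → ind (toℕ x ≡ᵇ toℕ k)) ≡ 1
∑-allFin-single {suc n} Fin.zero =
  trans (∑-allFin-suc {n} (λ x → ind (toℕ x ≡ᵇ 0))) (cong suc (∑-const 0 (allFin n)))
∑-allFin-single {suc n} (Fin.suc k) =
  trans (∑-allFin-suc {n} (λ x → ind (toℕ x ≡ᵇ suc (toℕ k)))) (∑-allFin-single k)

rank : ∀ {h} → (Fin h → List ℕ) → Fin h → ℕ
rank {h} κ k = ∑ (allFin h) (λ x → ind (lexLT (κ x) (κ k)))

Adjacent : ∀ {h} → (Fin h → List ℕ) → Fin h → Fin h → Set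
Adjacent κ k k' = ∀ x → κ x ≺ κ k' ⇔ (κ x ≺ κ k ⊎ x ≡ k)

module _ {h : ℕ} (κ : Fin h → List ℕ) where

  rank-mono-< : ∀ {a b} → κ a ≺ κ b → rank κ a < rank κ b
  rank-mono-< {a} {b} a≺b = ∑-mono-< (∈-allFin a) at-a below
    where
    at-a : ind (lexLT (κ a) (κ a)) < ind (lexLT (κ a) (κ b))
    at-a = subst₂ _<_ (sym (ind-false (≺-irrefl ∘ lexLT⇒≺ (κ a) (κ a)))) (sym (ind-true (≺⇒lexLT a≺b)))
                      (s≤s z≤n)
    below : ∀ x → ind (lexLT (κ x) (κ a)) ≤ ind (lexLT (κ x) (κ b))
    below x = ind-mono (λ x≺a → ≺⇒lexLT (≺-trans (lexLT⇒≺ (κ x) (κ a) x≺a) a≺b))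

  Adjacent⇒rank-suc : ∀ {k k'} → Adjacent κ k k' → rank κ k' ≡ suc (rank κ k)
  Adjacent⇒rank-suc {k} {k'} adjacent = begin
    rank κ k'                                                             ≡⟨ ∑-cong (allFin h) split ⟩
    ∑ (allFin h) (λ x → ind (lexLT (κ x) (κ k)) + ind (toℕ x ≡ᵇ toℕ k))   ≡⟨ ∑-+ _ _ (allFin h) ⟩
    rank κ k + ∑ (allFin h) (λ x → ind (toℕ x ≡ᵇ toℕ k))                  ≡⟨ cong (rank κ k +_)
                                                                                 (∑-allFin-single k) ⟩
    rank κ k + 1                                                          ≡⟨ +-comm (rank κ k) 1 ⟩
    suc (rank κ k)                                                        ∎
    where
    open ≡-Reasoning
    split : ∀ x → ind (lexLT (κ x) (κ k')) ≡ ind (lexLT (κ x) (κ k)) + ind (toℕ x ≡ᵇ toℕ k)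
    split x = ind-≡-+ (⇔.trans (lexLT⇔≺ (κ x) (κ k'))
                        (⇔.trans (adjacent x) (⇔.sym (lexLT⇔≺ (κ x) (κ k) ⊎-⇔ toℕ-≡ᵇ⇔≡ x k))))
                      (λ x≺k x≡k → ≺-irrefl (subst (λ z → κ z ≺ κ k) (Equivalence.to (toℕ-≡ᵇ⇔≡ x k) x≡k)
                                                    (lexLT⇒≺ (κ x) (κ k) x≺k)))

  rank-suc⇒Adjacent : (∀ {x y} → κ x ≡ κ y → x ≡ y) → ∀ {k k'} → rank κ k' ≡ suc (rank κ k) →
    Adjacent κ k k'
  rank-suc⇒Adjacent κ-injective {k} {k'} r[k']≡1+r[k] x = mk⇔ to from
    where
    no-rank-between : ∀ {y} → κ k ≺ κ y → ¬ κ y ≺ κ k'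
    no-rank-between {y} k≺y y≺k' =
      <⇒≱ (rank-mono-< k≺y) (≤-pred (subst (rank κ y <_) r[k']≡1+r[k] (rank-mono-< y≺k')))
    k≺k' : κ k ≺ κ k'
    k≺k' with ≺-compare (κ k) (κ k')
    ... | inj₁ k≺k' = k≺k'
    ... | inj₂ (inj₁ κk≡κk') =
      ⊥-elim (1+n≢n (sym (trans (cong (rank κ) (κ-injective κk≡κk')) r[k']≡1+r[k])))
    ... | inj₂ (inj₂ k'≺k) =
      ⊥-elim (<⇒≱ (rank-mono-< k'≺k) (subst (rank κ k ≤_) (sym r[k']≡1+r[k]) (n≤1+n (rank κ k))))
    to : κ x ≺ κ k' → κ x ≺ κ k ⊎ x ≡ k
    to x≺k' with ≺-compare (κ x) (κ k)
    ... | inj₁ x≺k = inj₁ x≺k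
    ... | inj₂ (inj₁ κx≡κk) = inj₂ (κ-injective κx≡κk)
    ... | inj₂ (inj₂ k≺x) = ⊥-elim (no-rank-between k≺x x≺k')
    from : κ x ≺ κ k ⊎ x ≡ k → κ x ≺ κ k'
    from (inj₁ x≺k) = ≺-trans x≺k k≺k'
    from (inj₂ refl) = k≺k'

Adjacent-∷ : ∀ {h} {κ : Fin h → List ℕ} (s : Fin h → ℕ) {k k'} → Adjacent κ k k' → s k ≡ s k' →
  Adjacent (λ x → s x ∷ κ x) k k'
Adjacent-∷ s {k} {k'} adjacent sk≡sk' x with <-cmp (s x) (s k)
... | tri< sx<sk _ _ = mk⇔ (λ _ → inj₁ (this sx<sk)) (λ _ → this (subst (s x <_) sk≡sk' sx<sk))
... | tri> _ sx≢sk sk<sx =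
  mk⇔ (λ x≺k' → ⊥-elim (<⇒≱ sk<sx (subst (s x ≤_) (sym sk≡sk') (≺-∷-head x≺k'))))
      [ (λ x≺k → ⊥-elim (<⇒≱ sk<sx (≺-∷-head x≺k))) , (λ x≡k → ⊥-elim (sx≢sk (cong s x≡k))) ]′
... | tri≈ _ sx≡sk _ =
  ⇔.trans (≺-∷-≡⇔ (trans sx≡sk sk≡sk')) (⇔.trans (adjacent x) (⇔.sym (≺-∷-≡⇔ sx≡sk) ⊎-⇔ ⇔.refl))

nthD-tabulate : ∀ {A : Set} {n} d (f : Fin n → A) k → nthD d (tabulate f) (toℕ k) ≡ f k
nthD-tabulate d f Fin.zero = refl
nthD-tabulate d f (Fin.suc k) = nthD-tabulate d (f ∘ Fin.suc) k

take-suc : ∀ (xs : List ℕ) {j} → j < length xs → take (suc j) xs ≡ take j xs ++ [ nth xs j ]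
take-suc (x ∷ xs) {zero} _ = refl
take-suc (x ∷ xs) {suc j} j<1+n = cong (x ∷_) (take-suc xs (≤-pred j<1+n))

rank-cong : ∀ {h} {κ κ' : Fin h → List ℕ} → (∀ x → κ x ≡ κ' x) → ∀ k → rank κ k ≡ rank κ' k
rank-cong {h} κ≗κ' k = ∑-cong (allFin h) (λ x → cong₂ (λ a b → ind (lexLT a b)) (κ≗κ' x) (κ≗κ' k))

module Columns {h w σ : ℕ} (S : Fin h → Vec (Fin σ) w) where
  open PBWT S renaming (sym to symbol)

  key-injective : ∀ j {k k'} → key j k ≡ key j k' → k ≡ k'
  key-injective j {k} {k'} eq = toℕ-injective (∷ʳ-injectiveʳ (reverse (take j (row k))) (reverse (take j (row k'))) eq)

  symbol-row : ∀ k j → symbol (toℕ k) j ≡ nth (row k) j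
  symbol-row k j = cong (λ r → nth r j) (trans (cong (λ xs → nthD [] xs (toℕ k)) (map-tabulate id row))
                                               (nthD-tabulate [] row k))

  key-suc : ∀ {j} k → j < w → key (suc j) k ≡ symbol (toℕ k) j ∷ key j k
  key-suc {j} k j<w = begin
    reverse (take (suc j) (row k)) ++ [ toℕ k ]
      ≡⟨ cong (λ xs → reverse xs ++ [ toℕ k ]) (take-suc (row k) j<length) ⟩
    reverse (take j (row k) ++ [ nth (row k) j ]) ++ [ toℕ k ]
      ≡⟨ cong (_++ [ toℕ k ]) (reverse-++ (take j (row k)) _) ⟩
    nth (row k) j ∷ key j k
      ≡⟨ cong (_∷ key j k) (symbol-row k j) ⟨
    symbol (toℕ k) j ∷ key j k
      ∎
    where
    open ≡-Reasoning
    j<length : j < length (row k)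
    j<length = subst (j <_) (sym (trans (length-map toℕ (toList (S k))) (length-toList (S k)))) j<w

  keyed : ℕ → List (List ℕ × ℕ)
  keyed j = map (λ k → key j k , toℕ k) (allFin h)

  PA-↭ : ∀ j → PA j ↭ map toℕ (allFin h)
  PA-↭ j = ↭-trans (↭.map⁺ proj₂ (sortBy-↭ ltKey (keyed j))) (↭-reflexive (sym (map-∘ (allFin h))))

  length-PA : ∀ j → length (PA j) ≡ h
  length-PA j = trans (↭-length (PA-↭ j)) (trans (length-map toℕ (allFin h)) (length-tabulate id))

  PA-unique : ∀ j → Unique (PA j)
  PA-unique j = Unique-resp-↭ (↭⇒↭ₛ (↭-sym (PA-↭ j))) (Unique.map⁺ toℕ-injective (Unique.allFin⁺ h))

  ∈-PA : ∀ j k → toℕ k ∈ PA j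
  ∈-PA j k = ∈-resp-↭ (↭-sym (PA-↭ j)) (∈-map⁺ toℕ (∈-allFin k))

  indexOf-PA : ∀ j k → indexOf (toℕ k) (PA j) ≡ rank (key j) k
  indexOf-PA j k = begin
    indexOf (toℕ k) (PA j)
      ≡⟨ indexOf-sorted sorted (sortBy-sorted (keyed j) keys-distinct) entry key-of ⟩
    ∑ sorted (λ q → ind (lexLT (proj₁ q) (key j k)))
      ≡⟨ ∑-↭ _ (sortBy-↭ ltKey (keyed j)) ⟩
    ∑ (keyed j) (λ q → ind (lexLT (proj₁ q) (key j k)))
      ≡⟨ ∑-map _ _ (allFin h) ⟩
    rank (key j) k
      ∎
    where
    open ≡-Reasoning
    sorted = sortBy ltKey (keyed j)
    keys-distinct : AllPairs (λ p q → proj₁ p ≢ proj₁ q) (keyed j)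
    keys-distinct = AllPairs.map⁺ (AllPairs.map (λ k≢k' eq → k≢k' (key-injective j eq)) (Unique.allFin⁺ h))
    entry : (key j k , toℕ k) ∈ sorted
    entry = ∈-resp-↭ (↭-sym (sortBy-↭ ltKey (keyed j))) (∈-map⁺ (λ k → key j k , toℕ k) (∈-allFin k))
    key-of : ∀ {q} → q ∈ sorted → proj₂ q ≡ toℕ k → proj₁ q ≡ key j k
    key-of q∈ eq with ∈-map⁻ (λ k → key j k , toℕ k) (∈-resp-↭ (sortBy-↭ ltKey (keyed j)) q∈)
    ... | k' , _ , refl = cong (key j) (toℕ-injective eq)

  nth-PA-rank : ∀ j k → nth (PA j) (rank (key j) k) ≡ toℕ k
  nth-PA-rank j k = subst (λ i → nth (PA j) i ≡ toℕ k) (indexOf-PA j k) (nth-indexOf (PA j) (∈-PA j k))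

  rank<h : ∀ j k → rank (key j) k < h
  rank<h j k = subst₂ _<_ (indexOf-PA j k) (length-PA j) (indexOf<length (PA j) (∈-PA j k))

  rank-surjective : ∀ j {i} → i < h → ∃[ k ] rank (key j) k ≡ i
  rank-surjective j {i} i<h with ∈-map⁻ toℕ (∈-resp-↭ (PA-↭ j) (nth∈ (PA j) i<length))
    where
    i<length : i < length (PA j)
    i<length = subst (i <_) (sym (length-PA j)) i<h
  ... | k , _ , PAᵢ≡k = k , (begin
    rank (key j) k                ≡⟨ indexOf-PA j k ⟨
    indexOf (toℕ k) (PA j)        ≡⟨ cong (λ x → indexOf x (PA j)) PAᵢ≡k ⟨
    indexOf (nth (PA j) i) (PA j) ≡⟨ indexOf-nth (PA j) (PA-unique j) (subst (i <_) (sym (length-PA j)) i<h) ⟩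
    i                             ∎)
    where open ≡-Reasoning

  -- fore j and back (suc j) unfold to transfer j (suc j) and transfer (suc j) j.
  transfer : ℕ → ℕ → ℕ → ℕ
  transfer p q i = indexOf (nth (PA p) i) (PA q)

  transfer-rank : ∀ p q k → transfer p q (rank (key p) k) ≡ rank (key q) k
  transfer-rank p q k = trans (cong (λ x → indexOf x (PA q)) (nth-PA-rank p k)) (indexOf-PA q k)

  transfer<h : ∀ p q {i} → i < h → transfer p q i < h
  transfer<h p q i<h with rank-surjective p i<h
  ... | k , refl = subst (_< h) (sym (transfer-rank p q k)) (rank<h q k)

  transfer-inverse : ∀ p q {i} → i < h → transfer q p (transfer p q i) ≡ i
  transfer-inverse p q i<h with rank-surjective p i<h
  ... | k , refl = trans (cong (transfer q p) (transfer-rank p q k)) (transfer-rank q p k)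

  transfer-injective : ∀ p q {x y} → x < h → y < h → transfer p q x ≡ transfer p q y → x ≡ y
  transfer-injective p q x<h y<h eq =
    trans (sym (transfer-inverse p q x<h)) (trans (cong (transfer q p) eq) (transfer-inverse p q y<h))

  PBWT-rank : ∀ j k → nth (PBWTcol j) (rank (key j) k) ≡ symbol (toℕ k) j
  PBWT-rank j k = trans (nth-map (λ k → symbol k j) (PA j) (subst (rank (key j) k <_) (sym (length-PA j)) (rank<h j k)))
                        (cong (λ k → symbol k j) (nth-PA-rank j k))

  rank-suc-step : ∀ {j k k'} → j < w → rank (key j) k' ≡ suc (rank (key j) k) →
    symbol (toℕ k) j ≡ symbol (toℕ k') j → rank (key (suc j)) k' ≡ suc (rank (key (suc j)) k)
  rank-suc-step {j} {k} {k'} j<w r[k']≡1+r[k] same-symbol = begin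
    rank (key (suc j)) k'         ≡⟨ rank-cong key-suc′ k' ⟩
    rank κ′ k'                    ≡⟨ Adjacent⇒rank-suc κ′ (Adjacent-∷ s adjacent same-symbol) ⟩
    suc (rank κ′ k)               ≡⟨ cong suc (rank-cong key-suc′ k) ⟨
    suc (rank (key (suc j)) k)    ∎
    where
    open ≡-Reasoning
    s : Fin h → ℕ
    s x = symbol (toℕ x) j
    κ′ : Fin h → List ℕ
    κ′ x = s x ∷ key j x
    key-suc′ : ∀ x → key (suc j) x ≡ κ′ x
    key-suc′ x = key-suc x j<w
    adjacent : Adjacent (key j) k k'
    adjacent = rank-suc⇒Adjacent (key j) (key-injective j) r[k']≡1+r[k]

  fore-step : ∀ {j i} → j < w → suc i < h → nth (PBWTcol j) i ≡ nth (PBWTcol j) (suc i) →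
    fore j (suc i) ≡ suc (fore j i)
  fore-step {j} {i} j<w 1+i<h same-symbol
    with rank-surjective j (<-trans (n<1+n i) 1+i<h) | rank-surjective j 1+i<h
  ... | k , refl | k' , r[k']≡1+r[k] = begin
    fore j (suc (rank (key j) k))    ≡⟨ cong (fore j) r[k']≡1+r[k] ⟨
    fore j (rank (key j) k')         ≡⟨ transfer-rank j (suc j) k' ⟩
    rank (key (suc j)) k'            ≡⟨ rank-suc-step j<w r[k']≡1+r[k] s[k]≡s[k'] ⟩
    suc (rank (key (suc j)) k)       ≡⟨ cong suc (transfer-rank j (suc j) k) ⟨
    suc (fore j (rank (key j) k))    ∎
    where
    open ≡-Reasoning
    s[k]≡s[k'] : symbol (toℕ k) j ≡ symbol (toℕ k') j
    s[k]≡s[k'] = begin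
      symbol (toℕ k) j                          ≡⟨ PBWT-rank j k ⟨
      nth (PBWTcol j) (rank (key j) k)          ≡⟨ same-symbol ⟩
      nth (PBWTcol j) (suc (rank (key j) k))    ≡⟨ cong (nth (PBWTcol j)) r[k']≡1+r[k] ⟨
      nth (PBWTcol j) (rank (key j) k')         ≡⟨ PBWT-rank j k' ⟩
      symbol (toℕ k') j                         ∎

-- Run intervals

Run : Set
Run = ℕ × Interval

ConsecutiveFrom : ℕ → List Run → Set
ConsecutiveFrom p [] = ⊤
ConsecutiveFrom p ((_ , b , e) ∷ L) = b ≡ p × b ≤ e × ConsecutiveFrom (suc e) L

RunOf : ℕ → List ℕ → Run → Set
RunOf p xs (s , b , e) = e < p + length xs × (∀ {i} → b ≤ p + i → p + i ≤ e → nth xs i ≡ s)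

runsFrom-consecutive : ∀ p xs → ConsecutiveFrom p (runsFrom p xs)
runsFrom-consecutive p [] = tt
runsFrom-consecutive p (x ∷ xs) with runsFrom (suc p) xs | runsFrom-consecutive (suc p) xs
... | [] | _ = refl , ≤-refl , tt
... | (y , b , e) ∷ rest | refl , b≤e , rest-consecutive with x ≡ᵇ y
...   | true = refl , <⇒≤ b≤e , rest-consecutive
...   | false = refl , ≤-refl , refl , b≤e , rest-consecutive

consecutive-above : ∀ {p} L → ConsecutiveFrom p L → All (λ r → p ≤ proj₁ (proj₂ r)) L
consecutive-above [] _ = []
consecutive-above ((s , b , e) ∷ L) (refl , b≤e , rest) =
  ≤-refl ∷ All.map (λ 1+e≤b' → ≤-trans (m≤n⇒m≤1+n b≤e) 1+e≤b') (consecutive-above L rest)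

consecutive-proper : ∀ {p} L → ConsecutiveFrom p L → All (Proper ∘ proj₂) L
consecutive-proper [] _ = []
consecutive-proper ((s , b , e) ∷ L) (_ , b≤e , rest) = b≤e ∷ consecutive-proper L rest

RunOf-∷ : ∀ {p x xs s b e} → (b ≤ p → x ≡ s) → (∀ {i} → b ≤ suc p + i → suc p + i ≤ e → nth xs i ≡ s) →
  e < suc p + length xs → RunOf p (x ∷ xs) (s , b , e)
RunOf-∷ {p} {x} {xs} {s} {b} {e} head tail e<1+p+n = subst (e <_) (sym (+-suc p (length xs))) e<1+p+n , constant
  where
  constant : ∀ {i} → b ≤ p + i → p + i ≤ e → nth (x ∷ xs) i ≡ s
  constant {zero} b≤p+0 _ = head (subst (b ≤_) (+-identityʳ p) b≤p+0)
  constant {suc i} b≤p+1+i p+1+i≤e = tail (subst (b ≤_) (+-suc p i) b≤p+1+i) (subst (_≤ e) (+-suc p i) p+1+i≤e)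

RunOf-single : ∀ {p x xs} → RunOf p (x ∷ xs) (x , p , p)
RunOf-single {p} {xs = xs} =
  RunOf-∷ (λ _ → refl) (λ _ 1+p+i≤p → ⊥-elim (<⇒≱ (s≤s (m≤m+n p _)) 1+p+i≤p)) (s≤s (m≤m+n p (length xs)))

RunOf-shift : ∀ {p x xs r} → suc p ≤ proj₁ (proj₂ r) → RunOf (suc p) xs r → RunOf p (x ∷ xs) r
RunOf-shift 1+p≤b (e<n , constant) = RunOf-∷ (λ b≤p → ⊥-elim (<⇒≱ 1+p≤b b≤p)) constant e<n

All-RunOf-shift : ∀ {p x xs L} → All (λ r → suc p ≤ proj₁ (proj₂ r)) L → All (RunOf (suc p) xs) L →
  All (RunOf p (x ∷ xs)) L
All-RunOf-shift above runs = All.zipWith (λ (1+p≤b , run) → RunOf-shift 1+p≤b run) (above , runs)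

runsFrom-runs : ∀ p xs → All (RunOf p xs) (runsFrom p xs)
runsFrom-runs p [] = []
runsFrom-runs p (x ∷ xs)
  with runsFrom (suc p) xs | runsFrom-consecutive (suc p) xs | runsFrom-runs (suc p) xs
... | [] | _ | _ = RunOf-single ∷ []
... | (y , b , e) ∷ rest | consecutive@(refl , _ , _) | runs@((e<n , y-constant) ∷ rest-runs)
  with x ≡ᵇ y | ≡ᵇ-reflects-≡ x y | consecutive-above ((y , b , e) ∷ rest) consecutive
...   | true | ofʸ refl | _ ∷ rest-above =
  RunOf-∷ (λ _ → refl) (λ {i} _ → y-constant (m≤m+n (suc p) i)) e<n ∷ All-RunOf-shift rest-above rest-runs
...   | false | _ | above = RunOf-single ∷ All-RunOf-shift above runs

cover-below : ∀ {p y} L → ConsecutiveFrom p L → y < p → cover (map proj₂ L) y ≡ 0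
cover-below [] _ _ = refl
cover-below {y = y} ((s , b , e) ∷ L) (refl , b≤e , rest) y<b =
  cong₂ _+_ (ind-false (λ y∈ → <⇒≱ y<b (proj₁ (intersects⁻ y y b e y∈))))
            (cover-below L rest (<-trans y<b (s≤s b≤e)))

Disjoint-consecutive : ∀ {p} L → ConsecutiveFrom p L → Disjoint (map proj₂ L)
Disjoint-consecutive [] _ y = z≤n
Disjoint-consecutive ((s , b , e) ∷ L) (refl , b≤e , rest) y with y ≤? e
... | yes y≤e = +-mono-≤ (ind≤1 (y ∈ᵇ (b , e))) (≤-reflexive (cover-below L rest (s≤s y≤e)))
... | no y≰e = +-mono-≤ (≤-reflexive (ind-false (λ y∈ → y≰e (proj₂ (intersects⁻ y y b e y∈)))))
                        (Disjoint-consecutive L rest y)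

Disjoint-runIntervals : ∀ xs → Disjoint (runIntervals xs)
Disjoint-runIntervals xs = Disjoint-consecutive (runsFrom 0 xs) (runsFrom-consecutive 0 xs)

SameAsNext : List ℕ → ℕ → Set
SameAsNext xs x = nth xs x ≡ nth xs (suc x)

runIntervals-segments : ∀ xs → All (Segment (length xs) (SameAsNext xs)) (runIntervals xs)
runIntervals-segments xs =
  All-map⁺ (All.zipWith segment (consecutive-proper (runsFrom 0 xs) (runsFrom-consecutive 0 xs) , runsFrom-runs 0 xs))
  where
  segment : ∀ {r} → Proper (proj₂ r) × RunOf 0 xs r → Segment (length xs) (SameAsNext xs) (proj₂ r)
  segment (b≤e , e<n , constant) =
    b≤e , e<n , λ b≤x x<e → trans (constant b≤x (<⇒≤ x<e)) (sym (constant (m≤n⇒m≤1+n b≤x) x<e))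

runIntervals-nonempty : ∀ xs → 1 ≤ length xs → 1 ≤ length (runIntervals xs)
runIntervals-nonempty (x ∷ xs) _ with runsFrom 1 xs
... | [] = s≤s z≤n
... | (y , _) ∷ _ with x ≡ᵇ y
...   | true = s≤s z≤n
...   | false = s≤s z≤n

-- Telescoping sums

Σ<-suc : ∀ n f → Σ< (suc n) f ≡ Σ< n f + f n
Σ<-suc n f = begin
  sum (map f (upTo (suc n)))        ≡⟨ cong (sum ∘ map f) (upTo-∷ʳ n) ⟨
  sum (map f (upTo n ∷ʳ n))         ≡⟨ cong sum (map-++ f (upTo n) [ n ]) ⟩
  sum (map f (upTo n) ++ [ f n ])   ≡⟨ sum-++ (map f (upTo n)) [ f n ] ⟩
  Σ< n f + (f n + 0)                ≡⟨ cong (Σ< n f +_) (+-identityʳ (f n)) ⟩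
  Σ< n f + f n                      ∎
  where open ≡-Reasoning

Σ<-cons : ∀ n f → Σ< (suc n) f ≡ f 0 + Σ< n (f ∘ suc)
Σ<-cons n f = cong (f 0 +_) (cong sum (trans (map-applyUpTo suc f n) (sym (map-upTo (f ∘ suc) n))))

Σ<-reverse : ∀ n f → Σ< n (λ j → f (n ∸ 1 ∸ j)) ≡ Σ< n f
Σ<-reverse zero f = refl
Σ<-reverse (suc n) f = begin
  Σ< (suc n) (λ j → f (n ∸ j))         ≡⟨ Σ<-cons n (λ j → f (n ∸ j)) ⟩
  f n + Σ< n (λ j → f (n ∸ suc j))     ≡⟨ cong (λ g → f n + sum g)
                                                (map-cong (λ j → cong f (sym (∸-+-assoc n 1 j))) (upTo n)) ⟩
  f n + Σ< n (λ j → f (n ∸ 1 ∸ j))     ≡⟨ cong (f n +_) (Σ<-reverse n f) ⟩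
  f n + Σ< n f                         ≡⟨ +-comm (f n) (Σ< n f) ⟩
  Σ< n f + f n                         ≡⟨ Σ<-suc n f ⟨
  Σ< (suc n) f                         ∎
  where open ≡-Reasoning

Σ<-telescope : ∀ (s r : ℕ → ℕ) n → s 0 ≤ r 0 → (∀ m → suc m < suc n → 3 * s (suc m) ≤ 3 * r (suc m) + s m) →
  2 * Σ< (suc n) s + s n ≤ 3 * Σ< (suc n) r
Σ<-telescope s r zero s₀≤r₀ _ = begin
  2 * (s 0 + 0) + s 0   ≡⟨ regroup (s 0) ⟩
  3 * s 0               ≤⟨ *-monoʳ-≤ 3 s₀≤r₀ ⟩
  3 * r 0               ≡⟨ cong (3 *_) (+-identityʳ (r 0)) ⟨
  3 * (r 0 + 0)         ∎
  where
  open ≤-Reasoning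
  regroup : ∀ a → 2 * (a + 0) + a ≡ 3 * a
  regroup = solve-∀
Σ<-telescope s r (suc n) s₀≤r₀ step = begin
  2 * Σ< (suc (suc n)) s + s (suc n)           ≡⟨ cong (λ z → 2 * z + s (suc n)) (Σ<-suc (suc n) s) ⟩
  2 * (Σ< (suc n) s + s (suc n)) + s (suc n)   ≡⟨ regroup₁ (Σ< (suc n) s) (s (suc n)) ⟩
  2 * Σ< (suc n) s + 3 * s (suc n)             ≤⟨ +-monoʳ-≤ (2 * Σ< (suc n) s) (step n ≤-refl) ⟩
  2 * Σ< (suc n) s + (3 * r (suc n) + s n)     ≡⟨ regroup₂ (2 * Σ< (suc n) s) (3 * r (suc n)) (s n) ⟩
  (2 * Σ< (suc n) s + s n) + 3 * r (suc n)     ≤⟨ +-monoˡ-≤ (3 * r (suc n)) telescope ⟩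
  3 * Σ< (suc n) r + 3 * r (suc n)             ≡⟨ *-distribˡ-+ 3 (Σ< (suc n) r) (r (suc n)) ⟨
  3 * (Σ< (suc n) r + r (suc n))               ≡⟨ cong (3 *_) (Σ<-suc (suc n) r) ⟨
  3 * Σ< (suc (suc n)) r                       ∎
  where
  open ≤-Reasoning
  telescope : 2 * Σ< (suc n) s + s n ≤ 3 * Σ< (suc n) r
  telescope = Σ<-telescope s r n s₀≤r₀ (λ m m<n → step m (m<n⇒m<1+n m<n))
  regroup₁ : ∀ a b → 2 * (a + b) + b ≡ 2 * a + 3 * b
  regroup₁ = solve-∀
  regroup₂ : ∀ a b c → a + (b + c) ≡ (a + c) + b
  regroup₂ = solve-∀

Σ<-bound : ∀ (s r : ℕ → ℕ) n → 1 ≤ n → s 0 ≤ r 0 → 1 ≤ r 0 →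
  (∀ m → suc m < n → 3 * s (suc m) ≤ 3 * r (suc m) + s m) → Σ< n s < 2 * Σ< n r
Σ<-bound s r (suc n) _ s₀≤r₀ 1≤r₀ step = *-cancelˡ-< 2 (Σ< (suc n) s) (2 * Σ< (suc n) r) (begin-strict
  2 * Σ< (suc n) s                  ≤⟨ m≤m+n _ (s n) ⟩
  2 * Σ< (suc n) s + s n            ≤⟨ Σ<-telescope s r n s₀≤r₀ step ⟩
  3 * Σ< (suc n) r                  <⟨ m<m+n (3 * Σ< (suc n) r) 1≤Σr ⟩
  3 * Σ< (suc n) r + Σ< (suc n) r   ≡⟨ regroup (Σ< (suc n) r) ⟩
  2 * (2 * Σ< (suc n) r)            ∎)
  where
  open ≤-Reasoning
  1≤Σr : 1 ≤ Σ< (suc n) r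
  1≤Σr = ≤-trans 1≤r₀ (≤-trans (m≤m+n (r 0) _) (≤-reflexive (sym (Σ<-cons n r))))
  regroup : ∀ a → 3 * a + a ≡ 2 * (2 * a)
  regroup = solve-∀

module Bounds {h w σ : ℕ} (S : Fin h → Vec (Fin σ) w) where
  open PBWT S hiding (sym)
  open Columns S

  InRun : ℕ → Interval → Set
  InRun j = Segment h (SameAsNext (PBWTcol j))

  length-PBWTcol : ∀ j → length (PBWTcol j) ≡ h
  length-PBWTcol j = trans (length-map _ (PA j)) (length-PA j)

  intervals-disjoint : ∀ j → Disjoint (intervals j)
  intervals-disjoint j = Disjoint-runIntervals (PBWTcol j)

  intervals-in-runs : ∀ j → All (InRun j) (intervals j)
  intervals-in-runs j =
    subst (λ n → All (Segment n (SameAsNext (PBWTcol j))) (intervals j)) (length-PBWTcol j)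
          (runIntervals-segments (PBWTcol j))

  intervals-proper : ∀ j → All Proper (intervals j)
  intervals-proper j = All.map proj₁ (intervals-in-runs j)

  1≤r : 1 ≤ h → ∀ j → 1 ≤ r j
  1≤r 1≤h j = runIntervals-nonempty (PBWTcol j) (subst (1 ≤_) (sym (length-PBWTcol j)) 1≤h)

  fore-shifts : ∀ {j I} → j < w → InRun j I → Segment h (ShiftStep (fore j)) I
  fore-shifts j<w (b≤e , e<h , same) = b≤e , e<h , λ b≤x x<e → fore-step j<w (≤-<-trans x<e e<h) (same b≤x x<e)

  back-shifts : ∀ {j I} → j < w → InRun j I → Segment h (ShiftStep (back (suc j))) (mapEnds (fore j) I)
  back-shifts {j} {I} j<w I-in-run@(b≤e , e<h , _) =
    shift-Proper b≤e steps ,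
    transfer<h j (suc j) e<h ,
    inverse-shifts b≤e steps (λ _ x≤e → transfer-inverse j (suc j) (≤-<-trans x≤e e<h))
    where
    steps : EachStep (ShiftStep (fore j)) I
    steps = proj₂ (proj₂ (fore-shifts j<w I-in-run))

  module _ {j} (j<w : j < w) {L} (L-in-runs : All (InRun j) L) where

    foreL-proper : All Proper (foreL j L)
    foreL-proper = All-Proper-sortBy-mapEnds _ (fore j) L (All.map (fore-shifts j<w) L-in-runs)

    foreL-disjoint : Disjoint L → Disjoint (foreL j L)
    foreL-disjoint =
      Disjoint-sortBy-mapEnds _ (fore j) L (transfer-injective j (suc j)) (All.map (fore-shifts j<w) L-in-runs)

  length-foreL : ∀ j L → length (foreL j L) ≡ length L
  length-foreL j = length-sortBy-mapEnds _ (fore j)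

  SubIB-Invariant : ℕ → Set
  SubIB-Invariant j = Disjoint (SubIB j) × All (InRun j) (SubIB j)

  module SubIB-step (j : ℕ) (1+j<w : suc j < w) (invariant : SubIB-Invariant j) where
    private
      j<w : j < w
      j<w = <-trans (n<1+n j) 1+j<w
    open Normalization (foreL-proper j<w (proj₂ invariant)) (foreL-disjoint j<w (proj₂ invariant) (proj₁ invariant))

    invariant-suc : SubIB-Invariant (suc j)
    invariant-suc = Disjoint-normalization (intervals-proper (suc j)) (intervals-disjoint (suc j)) ,
                    All-normalization _ Segment-⊆ (intervals-proper (suc j)) (intervals-in-runs (suc j))

    length-bound : 3 * length (SubIB (suc j)) ≤ 3 * r (suc j) + length (SubIB j)
    length-bound = subst (λ n → 3 * length (SubIB (suc j)) ≤ 3 * r (suc j) + n) (length-foreL j (SubIB j))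
                         (length-normalization (intervals-proper (suc j)) (intervals-disjoint (suc j)))

  SubIB-invariant : ∀ j → j < w → SubIB-Invariant j
  SubIB-invariant zero _ = intervals-disjoint 0 , intervals-in-runs 0
  SubIB-invariant (suc j) 1+j<w = SubIB-step.invariant-suc j 1+j<w (SubIB-invariant j (<-trans (n<1+n j) 1+j<w))

  length-SubIB-suc : ∀ j → suc j < w → 3 * length (SubIB (suc j)) ≤ 3 * r (suc j) + length (SubIB j)
  length-SubIB-suc j 1+j<w = SubIB-step.length-bound j 1+j<w (SubIB-invariant j (<-trans (n<1+n j) 1+j<w))

  SubIF-Invariant : ℕ → Set
  SubIF-Invariant m = Disjoint (SubIFfromEnd m) × All Proper (SubIFfromEnd m)

  module SubIF-step (m : ℕ) (1+m<w : suc m < w) (invariant : SubIF-Invariant m) where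
    j : ℕ
    j = w ∸ 2 ∸ m

    private
      j<w : j < w
      j<w = subst (_< w) (sym (∸-+-assoc w 2 m)) (∸-monoʳ-< {o = 0} (s≤s z≤n) 1+m<w)
      Ip : List Interval
      Ip = foreL j (intervals j)
      Ip-proper : All Proper Ip
      Ip-proper = foreL-proper j<w (intervals-in-runs j)
      Ip-disjoint : Disjoint Ip
      Ip-disjoint = foreL-disjoint j<w (intervals-in-runs j) (intervals-disjoint j)
      Ip-back-shifts : All (Segment h (ShiftStep (back (suc j)))) Ip
      Ip-back-shifts =
        All-resp-↭ (↭-sym (sortBy-↭ _ _)) (All-map⁺ (All.map (back-shifts j<w) (intervals-in-runs j)))
    open Normalization (proj₂ invariant) (proj₁ invariant)

    private
      N : List Interval
      N = normalization Ip (SubIFfromEnd m)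
      N-back-shifts : All (Segment h (ShiftStep (back (suc j)))) N
      N-back-shifts = All-normalization _ Segment-⊆ Ip-proper Ip-back-shifts

    invariant-suc : SubIF-Invariant (suc m)
    invariant-suc =
      Disjoint-sortBy-mapEnds _ (back (suc j)) N (transfer-injective (suc j) j) N-back-shifts
                              (Disjoint-normalization Ip-proper Ip-disjoint) ,
      All-Proper-sortBy-mapEnds _ (back (suc j)) N N-back-shifts

    length-bound : 3 * length (SubIFfromEnd (suc m)) ≤ 3 * r j + length (SubIFfromEnd m)
    length-bound = subst₂ (λ a b → 3 * a ≤ 3 * b + length (SubIFfromEnd m))
                          (sym (length-sortBy-mapEnds _ (back (suc j)) N)) (length-foreL j (intervals j))
                          (length-normalization Ip-proper Ip-disjoint)

  SubIF-invariant : ∀ m → m < w → SubIF-Invariant m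
  SubIF-invariant zero _ = intervals-disjoint (w ∸ 1) , intervals-proper (w ∸ 1)
  SubIF-invariant (suc m) 1+m<w = SubIF-step.invariant-suc m 1+m<w (SubIF-invariant m (<-trans (n<1+n m) 1+m<w))

  length-SubIF-suc : ∀ m → suc m < w →
    3 * length (SubIFfromEnd (suc m)) ≤ 3 * r (w ∸ 1 ∸ suc m) + length (SubIFfromEnd m)
  length-SubIF-suc m 1+m<w =
    subst (λ j → 3 * length (SubIFfromEnd (suc m)) ≤ 3 * r j + length (SubIFfromEnd m)) w∸2∸m≡w∸1∸[1+m]
          (SubIF-step.length-bound m 1+m<w (SubIF-invariant m (<-trans (n<1+n m) 1+m<w)))
    where
    w∸2∸m≡w∸1∸[1+m] : w ∸ 2 ∸ m ≡ w ∸ 1 ∸ suc m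
    w∸2∸m≡w∸1∸[1+m] = trans (∸-+-assoc w 2 m) (sym (∸-+-assoc w 1 (suc m)))

  SubIB-bound : 1 ≤ h → 1 ≤ w → Σ< w (λ j → length (SubIB j)) < 2 * r̃
  SubIB-bound 1≤h 1≤w = Σ<-bound (λ j → length (SubIB j)) r w 1≤w ≤-refl (1≤r 1≤h 0) length-SubIB-suc

  SubIF-bound : 1 ≤ h → 1 ≤ w → Σ< w (λ j → length (SubIF j)) < 2 * r̃
  SubIF-bound 1≤h 1≤w =
    subst₂ (λ a b → a < 2 * b) (sym (Σ<-reverse w (λ m → length (SubIFfromEnd m)))) (Σ<-reverse w r)
           (Σ<-bound (λ m → length (SubIFfromEnd m)) (λ m → r (w ∸ 1 ∸ m)) w 1≤w ≤-refl (1≤r 1≤h (w ∸ 1))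
                     length-SubIF-suc)

lemma7 : (h w σ : ℕ) (S : Fin h → Vec (Fin σ) w) → 1 ≤ h → 1 ≤ w →
    (Σ< w (λ j → length (PBWT.SubIB S j)) < 2 * PBWT.r̃ S)
      × (Σ< w (λ j → length (PBWT.SubIF S j)) < 2 * PBWT.r̃ S)
lemma7 h w σ S 1≤h 1≤w = SubIB-bound 1≤h 1≤w , SubIF-bound 1≤h 1≤w
  where open Bounds S
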